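{- Let $P_3$ be the path on $3$ vertices. For all sufficiently large $n$, every separating set for $\mathrm{Hom}_{P_3,n}$ has size at most $n$.
   Context: $\mathrm{Hom}_{H,n}=\sum_{\phi}\prod_{e\in E(H)}x_{\phi(e)}$ is the polynomial in variables $x_{\{u,v\}}$ ($u\ne v\in[n]$), where $\phi$ ranges over all graph homomorphisms $H\to K_n$ (maps $V(H)\to[n]$ sending edges to edges) and $\phi(\{i,j\})=\{\phi(i),\phi(j)\}$. A separating set for a polynomial $p$ is a set $S$ of monomials of $p$ such that for any two monomials $s,t\in S$ there is no monomial $m$ of $p$ dividing the product $st$. -}

module Defs where

open import Data.Nat using (ℕ; _≤_; _<_)
open import Data.Fin using (Fin) renaming (_<_ to _<ᶠ_)
open import Data.Fin.Properties using (_≟_)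
open import Data.Bool using (if_then_else_; _∧_; _∨_)
open import Data.List using (List; []; _∷_; map)
open import Data.Nat.ListAction using (sum)
open import Data.List.Relation.Unary.All using (All)
open import Data.List.Membership.Propositional using (_∈_)
open import Data.List.Relation.Unary.AllPairs using (AllPairs)
open import Data.Product using (Σ; Σ-syntax; ∃; ∃-syntax; _×_; _,_)
open import Data.Sum using (_⊎_)
open import Relation.Nullary using (¬_)
open import Relation.Nullary.Decidable using (⌊_⌋)
open import Relation.Binary.PropositionalEquality using (_≡_; _≢_)

Graph : ℕ → Set
Graph k = List (Fin k × Fin k)

P₃ : Graph 3
P₃ = (Fin.zero , Fin.suc Fin.zero) ∷ (Fin.suc Fin.zero , Fin.suc (Fin.suc Fin.zero)) ∷ []
  where import Data.Fin as Fin

-- Variables x_{i,j} of Hom_{H,n}: unordered pairs {i,j} ⊆ [n], i ≠ j,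
-- represented canonically as (i , j) with i < j.
Edge : ℕ → Set
Edge n = Σ[ i ∈ Fin n ] Σ[ j ∈ Fin n ] (i <ᶠ j)

Monomial : ℕ → Set
Monomial n = Edge n → ℕ

_≈ₘ_ : ∀ {n} → Monomial n → Monomial n → Set
m ≈ₘ m' = ∀ e → m e ≡ m' e

_*ₘ_ : ∀ {n} → Monomial n → Monomial n → Monomial n
(s *ₘ t) e = s e Data.Nat.+ t e
  where import Data.Nat

_∣ₘ_ : ∀ {n} → Monomial n → Monomial n → Set
m ∣ₘ m' = ∀ e → m e ≤ m' e

IsHom : ∀ {k n} → Graph k → (Fin k → Fin n) → Set
IsHom H φ = All (λ { (u , v) → φ u ≢ φ v }) H

edgeCount : ∀ {n} → Fin n → Fin n → Fin n → Fin n → ℕ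
edgeCount a b i j =
  if (⌊ a ≟ i ⌋ ∧ ⌊ b ≟ j ⌋) ∨ (⌊ a ≟ j ⌋ ∧ ⌊ b ≟ i ⌋) then 1 else 0

homMonomial : ∀ {k n} → Graph k → (Fin k → Fin n) → Monomial n
homMonomial H φ (i , j , _) = sum (map (λ { (u , v) → edgeCount (φ u) (φ v) i j }) H)

-- m is a monomial of Hom_{H,n} = Σ_φ ∏_e x_{φ(e)}.  All coefficients are
-- positive integers (no cancellation), so the monomials occurring in
-- Hom_{H,n} are exactly the homMonomial H φ for homomorphisms φ.
IsMonomialOfHom : ∀ {k} → Graph k → (n : ℕ) → Monomial n → Set
IsMonomialOfHom {k} H n m = Σ[ φ ∈ (Fin k → Fin n) ] (IsHom H φ × (m ≈ₘ homMonomial H φ))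

IsSeparatingSet : ∀ {k} → Graph k → (n : ℕ) → List (Monomial n) → Set
IsSeparatingSet H n S =
  All (IsMonomialOfHom H n) S ×
  (∀ {s t} → s ∈ S → t ∈ S → ¬ (s ≈ₘ t) →
     ∀ m → IsMonomialOfHom H n m → m ∣ₘ (s *ₘ t) → (m ≈ₘ s) ⊎ (m ≈ₘ t))

-- The list has no repeated monomials (so its length is the size of the set).
NoDupₘ : ∀ {n} → List (Monomial n) → Set
NoDupₘ S = AllPairs (λ a b → ¬ (a ≈ₘ b)) S

-- A monomial of Hom_{P₃,n} is either a square x_{ab}² (from a walk a─b─a) or a
-- cherry x_{ab} x_{bc} with a ≠ c.  Label a square by its smaller endpoint and a
-- cherry by its largest vertex.  Two different members of a separating set never
-- share a label, because in each case a third monomial of Hom_{P₃,n} divides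
-- their product: for squares {v,p}, {v,q} the cherry p─v─q; for a square {v,p}
-- with v < p and a cherry with largest vertex v, the cherry p─v─u through an edge
-- {v,u} of the cherry; for two cherries through v, either the square of a common
-- edge (cherries have all exponents ≤ 1) or the cherry made of an edge at v from
-- each.  So the labelling is injective into [n], for every n.

module Submission where

open import Defs
open import Data.Nat using (ℕ; _≤_)
open import Data.List using (List; length)
open import Data.Product using (∃-syntax)

open import Algebra.Construct.NaturalChoice.Min as Min using ()
open import Algebra.Construct.NaturalChoice.Max as Max using ()
open import Data.Bool using (true; false; if_then_else_)
open import Data.Fin using (Fin; zero; suc) renaming (_≤_ to _≤ᶠ_; _<_ to _<ᶠ_)
open import Data.Fin.Properties
  using (_≟_; <-cmp; ≤-totalOrder; ≤∧≢⇒<; <⇒≢; injective⇒≤)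
open import Data.List using (lookup)
open import Data.List.Membership.Propositional.Properties using (∈-lookup)
open import Data.List.Relation.Unary.All as All using ([]; _∷_)
open import Data.List.Relation.Unary.AllPairs using (AllPairs; []; _∷_)
open import Data.Nat using (_+_; z≤n; s≤s)
open import Data.Nat.Properties
  using (m≤m+n; m≤n+m; ≤-refl; ≤-trans; ≤-reflexive; +-mono-≤; +-comm; +-identityʳ; <⇒≱)
open import Data.Product using (_×_; _,_)
open import Data.Sum as Sum using (_⊎_; inj₁; inj₂; [_,_]′)
open import Function.Definitions using (Injective)
open import Level using (Level)
open import Relation.Binary using (Rel; Symmetric; tri<; tri≈; tri>)
open import Relation.Binary.PropositionalEquality
  using (_≡_; _≢_; refl; sym; trans; cong; cong₂; subst; ≢-sym)
open import Relation.Nullary using (Dec; yes; no; does; ¬_; contradiction)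
open import Relation.Nullary.Decidable
  using (map′; _×-dec_; _⊎-dec_; isYes≗does; dec-true; dec-false)

private variable
  n : ℕ
  a b c a′ b′ c′ i j i′ j′ p v x y z : Fin n
  s t s′ t′ : Monomial n

data SamePair {n : ℕ} : (a b i j : Fin n) → Set where
  straight : SamePair a b a b
  swapped  : SamePair a b b a

SamePair-sym : SamePair a b i j → SamePair i j a b
SamePair-sym straight = straight
SamePair-sym swapped  = swapped

SamePair-trans : SamePair a b i j → SamePair i j i′ j′ → SamePair a b i′ j′
SamePair-trans straight q        = q
SamePair-trans swapped  straight = swapped
SamePair-trans swapped  swapped  = straight

SamePair-consecutive : SamePair a b b c → a ≡ c
SamePair-consecutive straight = refl
SamePair-consecutive swapped  = refl

SamePair-sharing : SamePair a b a c → b ≡ c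
SamePair-sharing straight = refl
SamePair-sharing swapped  = refl

samePair? : (a b i j : Fin n) → Dec (SamePair a b i j)
samePair? a b i j = map′ fromEqs toEqs ((a ≟ i ×-dec b ≟ j) ⊎-dec (a ≟ j ×-dec b ≟ i))
  where
  fromEqs : (a ≡ i × b ≡ j) ⊎ (a ≡ j × b ≡ i) → SamePair a b i j
  fromEqs (inj₁ (refl , refl)) = straight
  fromEqs (inj₂ (refl , refl)) = swapped
  toEqs : SamePair a b i j → (a ≡ i × b ≡ j) ⊎ (a ≡ j × b ≡ i)
  toEqs straight = inj₁ (refl , refl)
  toEqs swapped  = inj₂ (refl , refl)

edgeCount-reflects : (a b i j : Fin n) →
                     edgeCount a b i j ≡ (if does (samePair? a b i j) then 1 else 0)
edgeCount-reflects a b i j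
  rewrite isYes≗does (a ≟ i) | isYes≗does (b ≟ j)
        | isYes≗does (a ≟ j) | isYes≗does (b ≟ i) = refl

edgeCount-same : SamePair a b i j → edgeCount a b i j ≡ 1
edgeCount-same {a = a} {b} {i} {j} p
  rewrite edgeCount-reflects a b i j | dec-true (samePair? a b i j) p = refl

edgeCount-different : ¬ SamePair a b i j → edgeCount a b i j ≡ 0
edgeCount-different {a = a} {b} {i} {j} ¬p
  rewrite edgeCount-reflects a b i j | dec-false (samePair? a b i j) ¬p = refl

edgeCount-≤1 : (a b i j : Fin n) → edgeCount a b i j ≤ 1
edgeCount-≤1 a b i j rewrite edgeCount-reflects a b i j with does (samePair? a b i j)
... | true  = ≤-refl
... | false = z≤n

edgeCount-cong : SamePair a b a′ b′ → SamePair i j i′ j′ →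
                 edgeCount a b i j ≡ edgeCount a′ b′ i′ j′
edgeCount-cong {a = a} {b} {i = i} {j} p q with samePair? a b i j
... | yes e = trans (edgeCount-same e)
                    (sym (edgeCount-same (SamePair-trans (SamePair-sym p) (SamePair-trans e q))))
... | no ¬e = trans (edgeCount-different ¬e)
                    (sym (edgeCount-different λ e′ →
                      ¬e (SamePair-trans p (SamePair-trans e′ (SamePair-sym q)))))

path : Fin n → Fin n → Fin n → Fin 3 → Fin n
path a b c zero             = a
path a b c (suc zero)       = b
path a b c (suc (suc zero)) = c

pathMonomial : Fin n → Fin n → Fin n → Monomial n
pathMonomial a b c = homMonomial P₃ (path a b c)

-- The trailing + 0 makes exponent a b c i j the definitional value of
-- pathMonomial a b c at the pair {i, j}.
exponent : (a b c i j : Fin n) → ℕ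
exponent a b c i j = edgeCount a b i j + (edgeCount b c i j + 0)

exponent-cong : SamePair i j i′ j′ → exponent a b c i j ≡ exponent a b c i′ j′
exponent-cong {a = a} {b} {c} q =
  cong₂ _+_ (edgeCount-cong {a = a} {b} straight q)
            (cong (_+ 0) (edgeCount-cong {a = b} {c} straight q))

pairEdge : {i j : Fin n} → i ≢ j → Edge n
pairEdge {i = i} {j} i≢j with <-cmp i j
... | tri< i<j _ _ = i , j , i<j
... | tri≈ _ i≡j _ = contradiction i≡j i≢j
... | tri> _ _ j<i = j , i , j<i

pathMonomial-pairEdge : (i≢j : i ≢ j) → pathMonomial a b c (pairEdge i≢j) ≡ exponent a b c i j
pathMonomial-pairEdge {i = i} {j} {a} {b} {c} i≢j with <-cmp i j
... | tri< _ _ _   = refl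
... | tri≈ _ i≡j _ = contradiction i≡j i≢j
... | tri> _ _ _   = exponent-cong {a = a} {b} {c} swapped

pathMonomial-≉ : i ≢ j → exponent a b c i j ≢ exponent a′ b′ c′ i j →
                 ¬ pathMonomial a b c ≈ₘ pathMonomial a′ b′ c′
pathMonomial-≉ {a = a} {b} {c} {a′ = a′} {b′} {c′} i≢j ≢exp eq =
  ≢exp (trans (sym (pathMonomial-pairEdge {a = a} {b} {c} i≢j))
              (trans (eq (pairEdge i≢j)) (pathMonomial-pairEdge {a = a′} {b′} {c′} i≢j)))

EdgeOf : (a b c i j : Fin n) → Set
EdgeOf a b c i j = SamePair a b i j ⊎ SamePair b c i j

edgeOf? : (a b c i j : Fin n) → Dec (EdgeOf a b c i j)
edgeOf? a b c i j = samePair? a b i j ⊎-dec samePair? b c i j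

EdgeOf-sym : EdgeOf a b c i j → EdgeOf a b c j i
EdgeOf-sym (inj₁ e) = inj₁ (SamePair-trans e swapped)
EdgeOf-sym (inj₂ e) = inj₂ (SamePair-trans e swapped)

EdgeOf-≢ : a ≢ b → b ≢ c → EdgeOf a b c i j → i ≢ j
EdgeOf-≢ a≢b b≢c (inj₁ straight) = a≢b
EdgeOf-≢ a≢b b≢c (inj₁ swapped)  = ≢-sym a≢b
EdgeOf-≢ a≢b b≢c (inj₂ straight) = b≢c
EdgeOf-≢ a≢b b≢c (inj₂ swapped)  = ≢-sym b≢c

EdgeOf-square : EdgeOf x y x i j → SamePair x y i j
EdgeOf-square (inj₁ e) = e
EdgeOf-square (inj₂ e) = SamePair-trans swapped e

infix 4 _∈ᵥ_
_∈ᵥ_ : Fin n → (Fin 3 → Fin n) → Set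
v ∈ᵥ φ = ∃[ k ] φ k ≡ v

EdgeOf-∈ : EdgeOf a b c i j → i ∈ᵥ path a b c
EdgeOf-∈ (inj₁ straight) = zero , refl
EdgeOf-∈ (inj₁ swapped)  = suc zero , refl
EdgeOf-∈ (inj₂ straight) = suc zero , refl
EdgeOf-∈ (inj₂ swapped)  = suc (suc zero) , refl

edge-at : v ∈ᵥ path a b c → ∃[ u ] EdgeOf a b c u v
edge-at (zero , refl)           = _ , inj₁ swapped
edge-at (suc zero , refl)       = _ , inj₁ straight
edge-at (suc (suc zero) , refl) = _ , inj₂ straight

edgeCount-≤-exponent : EdgeOf a b c x y → edgeCount x y i j ≤ exponent a b c i j
edgeCount-≤-exponent (inj₁ e) =
  ≤-trans (≤-reflexive (edgeCount-cong (SamePair-sym e) straight)) (m≤m+n _ _)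
edgeCount-≤-exponent {a = a} {b} {c} {i = i} {j} (inj₂ e) =
  ≤-trans (≤-reflexive (trans (edgeCount-cong (SamePair-sym e) straight) (sym (+-identityʳ _))))
          (m≤n+m _ (edgeCount a b i j))

exponent-edge : EdgeOf a b c i j → 1 ≤ exponent a b c i j
exponent-edge {i = i} {j} e =
  ≤-trans (≤-reflexive (sym (edgeCount-same {a = i} {j} straight))) (edgeCount-≤-exponent e)

exponent-nonedge : ¬ EdgeOf a b c i j → exponent a b c i j ≡ 0
exponent-nonedge ¬e
  rewrite edgeCount-different (λ e → ¬e (inj₁ e)) | edgeCount-different (λ e → ¬e (inj₂ e)) = refl

exponent-≤1 : a ≢ c → exponent a b c i j ≤ 1
exponent-≤1 {a = a} {c} {b} {i} {j} a≢c with samePair? a b i j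
... | no ¬p rewrite edgeCount-different ¬p =
  subst (_≤ 1) (sym (+-identityʳ _)) (edgeCount-≤1 b c i j)
... | yes p rewrite edgeCount-same p
                  | edgeCount-different {a = b} {c} {i} {j}
                      (λ q → a≢c (SamePair-consecutive (SamePair-trans p (SamePair-sym q)))) = ≤-refl

exponent-square : exponent x y x x y ≡ 2
exponent-square {x = x} {y} =
  cong₂ _+_ (edgeCount-same {a = x} {y} straight) (cong (_+ 0) (edgeCount-same {a = y} {x} swapped))

pathMonomial-∣ : EdgeOf a b c x y → EdgeOf a′ b′ c′ y z →
                 pathMonomial x y z ∣ₘ (pathMonomial a b c *ₘ pathMonomial a′ b′ c′)
pathMonomial-∣ e e′ (i , j , _) =
  +-mono-≤ (edgeCount-≤-exponent e) (subst (_≤ _) (sym (+-identityʳ _)) (edgeCount-≤-exponent e′))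

pathMonomial-≉-edge : a ≢ b → b ≢ c → EdgeOf a b c i j → ¬ EdgeOf a′ b′ c′ i j →
                      ¬ pathMonomial a b c ≈ₘ pathMonomial a′ b′ c′
pathMonomial-≉-edge {a = a} {b} {c} {a′ = a′} {b′} {c′} a≢b b≢c e ¬e′ =
  pathMonomial-≉ {a = a} {b} {c} {a′ = a′} {b′} {c′} (EdgeOf-≢ a≢b b≢c e) λ eq →
    contradiction (subst (1 ≤_) (trans eq (exponent-nonedge ¬e′)) (exponent-edge e)) λ ()

Separates : {k : ℕ} → Graph k → Monomial n → Monomial n → Set
Separates {n = n} H s t = ∀ m → IsMonomialOfHom H n m → m ∣ₘ (s *ₘ t) → m ≈ₘ s ⊎ m ≈ₘ t

Separates-sym : {k : ℕ} {H : Graph k} → Separates H s t → Separates H t s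
Separates-sym {s = s} {t} sep m hom m∣ts =
  Sum.swap (sep m hom λ e → subst (m e ≤_) (+-comm (t e) (s e)) (m∣ts e))

Separates-resp-≈ : {k : ℕ} {H : Graph k} → s ≈ₘ s′ → t ≈ₘ t′ → Separates H s t → Separates H s′ t′
Separates-resp-≈ s≈s′ t≈t′ sep m hom m∣s′t′ =
  Sum.map (λ m≈s e → trans (m≈s e) (s≈s′ e)) (λ m≈t e → trans (m≈t e) (t≈t′ e))
    (sep m hom λ e → subst (m e ≤_) (sym (cong₂ _+_ (s≈s′ e) (t≈t′ e))) (m∣s′t′ e))

bridge-¬Separates : EdgeOf a b c x y → EdgeOf a′ b′ c′ y z → x ≢ y → y ≢ z →
                    ¬ pathMonomial x y z ≈ₘ pathMonomial a b c →
                    ¬ pathMonomial x y z ≈ₘ pathMonomial a′ b′ c′ →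
                    ¬ Separates P₃ (pathMonomial a b c) (pathMonomial a′ b′ c′)
bridge-¬Separates {x = x} {y} {z = z} e e′ x≢y y≢z ≉φ ≉ψ sep =
  [ ≉φ , ≉ψ ]′ (sep _ (path x y z , (x≢y ∷ y≢z ∷ []) , λ _ → refl) (pathMonomial-∣ e e′))

square-≉-cherry : x ≢ y → a ≢ c → ¬ pathMonomial x y x ≈ₘ pathMonomial a b c
square-≉-cherry {x = x} {y} {a} {c} {b} x≢y a≢c =
  pathMonomial-≉ {a = x} {y} {x} {a′ = a} {b} {c} x≢y λ eq →
    contradiction
      (subst (_≤ 1) (trans (sym eq) (exponent-square {x = x} {y})) (exponent-≤1 {b = b} a≢c))
      λ { (s≤s ()) }

common-edge-¬Separates : a ≢ b → b ≢ c → a ≢ c → a′ ≢ c′ →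
                         EdgeOf a b c x y → EdgeOf a′ b′ c′ x y →
                         ¬ Separates P₃ (pathMonomial a b c) (pathMonomial a′ b′ c′)
common-edge-¬Separates a≢b b≢c a≢c a′≢c′ e e′ =
  bridge-¬Separates e (EdgeOf-sym e′) x≢y (≢-sym x≢y)
    (square-≉-cherry x≢y a≢c) (square-≉-cherry x≢y a′≢c′)
  where x≢y = EdgeOf-≢ a≢b b≢c e

cherries-¬Separates : a ≢ b → b ≢ c → a ≢ c → a′ ≢ b′ → b′ ≢ c′ → a′ ≢ c′ →
                      v ∈ᵥ path a b c → v ∈ᵥ path a′ b′ c′ →
                      ¬ Separates P₃ (pathMonomial a b c) (pathMonomial a′ b′ c′)
cherries-¬Separates {a = a} {b} {c} {a′ = a′} {b′} {c′} {v = v}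
                    a≢b b≢c a≢c a′≢b′ b′≢c′ a′≢c′ v∈φ v∈ψ
  with edge-at v∈φ | edge-at v∈ψ
... | u , uv∈φ | u′ , u′v∈ψ with edgeOf? a b c v u′ | edgeOf? a′ b′ c′ u v
...   | yes vu′∈φ | _ =
  common-edge-¬Separates a≢b b≢c a≢c a′≢c′ vu′∈φ (EdgeOf-sym u′v∈ψ)
...   | no _ | yes uv∈ψ =
  common-edge-¬Separates a≢b b≢c a≢c a′≢c′ uv∈φ uv∈ψ
...   | no vu′∉φ | no uv∉ψ =
  bridge-¬Separates uv∈φ (EdgeOf-sym u′v∈ψ) u≢v v≢u′
    (pathMonomial-≉-edge u≢v v≢u′ (inj₂ straight) vu′∉φ)
    (pathMonomial-≉-edge u≢v v≢u′ (inj₁ straight) uv∉ψ)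
  where
  u≢v = EdgeOf-≢ a≢b b≢c uv∈φ
  v≢u′ = EdgeOf-≢ a′≢b′ b′≢c′ (EdgeOf-sym u′v∈ψ)

square-cherry-¬Separates : v <ᶠ p → a ≢ b → b ≢ c →
                           (∀ k → path a b c k ≤ᶠ v) → v ∈ᵥ path a b c →
                           ¬ Separates P₃ (pathMonomial v p v) (pathMonomial a b c)
square-cherry-¬Separates {v = v} {p} {a} {b} {c} v<p a≢b b≢c ≤v v∈ψ with edge-at v∈ψ
... | u , uv∈ψ = bridge-¬Separates (inj₁ swapped) (EdgeOf-sym uv∈ψ) p≢v v≢u pvu≉vpv pvu≉ψ
  where
  p∉ψ : ¬ p ∈ᵥ path a b c
  p∉ψ (k , ψk≡p) = <⇒≱ v<p (subst (_≤ᶠ v) ψk≡p (≤v k))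
  u≢p : u ≢ p
  u≢p u≡p = p∉ψ (subst (_∈ᵥ path a b c) u≡p (EdgeOf-∈ uv∈ψ))
  p≢v : p ≢ v
  p≢v p≡v = <⇒≢ v<p (sym p≡v)
  v≢u : v ≢ u
  v≢u = EdgeOf-≢ a≢b b≢c (EdgeOf-sym uv∈ψ)
  pvu≉vpv : ¬ pathMonomial p v u ≈ₘ pathMonomial v p v
  pvu≉vpv = pathMonomial-≉-edge p≢v v≢u (inj₂ straight) λ e →
    u≢p (sym (SamePair-sharing (EdgeOf-square e)))
  pvu≉ψ : ¬ pathMonomial p v u ≈ₘ pathMonomial a b c
  pvu≉ψ = pathMonomial-≉-edge p≢v v≢u (inj₁ straight) λ e → p∉ψ (EdgeOf-∈ e)

squares-separated : x ≢ y → x ≢ z → Separates P₃ (pathMonomial x y x) (pathMonomial x z x) → y ≡ z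
squares-separated {x = x} {y} {z} x≢y x≢z sep with y ≟ z
... | yes y≡z = y≡z
... | no y≢z  = contradiction sep
  (bridge-¬Separates (inj₁ swapped) (inj₁ straight) (≢-sym x≢y) x≢z yxz≉xyx yxz≉xzx)
  where
  yxz≉xyx : ¬ pathMonomial y x z ≈ₘ pathMonomial x y x
  yxz≉xyx = pathMonomial-≉-edge (≢-sym x≢y) x≢z (inj₂ straight) λ e →
    y≢z (SamePair-sharing (EdgeOf-square e))
  yxz≉xzx : ¬ pathMonomial y x z ≈ₘ pathMonomial x z x
  yxz≉xzx = pathMonomial-≉-edge (≢-sym x≢y) x≢z (inj₁ straight) λ e →
    y≢z (sym (SamePair-sharing (SamePair-trans (EdgeOf-square e) swapped)))

module _ {n : ℕ} where
  open Min (≤-totalOrder n) using (_⊓_; ⊓-sel; x⊓y≤x; x⊓y≤y)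
  open Max (≤-totalOrder n) using (_⊔_; ⊔-sel; x≤x⊔y; x≤y⊔x)

  label : (a b c : Fin n) → Fin n
  label a b c with a ≟ c
  ... | yes _ = a ⊓ b
  ... | no  _ = a ⊔ b ⊔ c

  square-normal : {a b : Fin n} → a ≢ b →
                  ∃[ p ] (a ⊓ b <ᶠ p × pathMonomial a b a ≈ₘ pathMonomial (a ⊓ b) p (a ⊓ b))
  square-normal {a} {b} a≢b with ⊓-sel a b
  ... | inj₁ a⊓b≡a rewrite a⊓b≡a =
    b , ≤∧≢⇒< (subst (_≤ᶠ b) a⊓b≡a (x⊓y≤y a b)) a≢b , λ _ → refl
  ... | inj₂ a⊓b≡b rewrite a⊓b≡b =
    a , ≤∧≢⇒< (subst (_≤ᶠ a) a⊓b≡b (x⊓y≤x a b)) (≢-sym a≢b) , square-flip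
    where
    square-flip : pathMonomial a b a ≈ₘ pathMonomial b a b
    square-flip (i , j , _) =
      cong₂ _+_ (edgeCount-cong {a = a} {b} swapped straight)
                (cong (_+ 0) (edgeCount-cong {a = b} {a} swapped straight))

  ≤-highest : {a b c : Fin n} → ∀ k → path a b c k ≤ᶠ a ⊔ b ⊔ c
  ≤-highest {a} {b} {c} zero             = ≤-trans (x≤x⊔y a b) (x≤x⊔y (a ⊔ b) c)
  ≤-highest {a} {b} {c} (suc zero)       = ≤-trans (x≤y⊔x a b) (x≤x⊔y (a ⊔ b) c)
  ≤-highest {a} {b} {c} (suc (suc zero)) = x≤y⊔x (a ⊔ b) c

  highest-∈ : {a b c : Fin n} → a ⊔ b ⊔ c ∈ᵥ path a b c
  highest-∈ {a} {b} {c} with ⊔-sel (a ⊔ b) c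
  ... | inj₂ eq = suc (suc zero) , sym eq
  ... | inj₁ eq with ⊔-sel a b
  ...   | inj₁ eq′ = zero , sym (trans eq eq′)
  ...   | inj₂ eq′ = suc zero , sym (trans eq eq′)

  squares-label : {a b a′ b′ : Fin n} → a ≢ b → a′ ≢ b′ →
                  ¬ pathMonomial a b a ≈ₘ pathMonomial a′ b′ a′ →
                  Separates P₃ (pathMonomial a b a) (pathMonomial a′ b′ a′) → a ⊓ b ≢ a′ ⊓ b′
  squares-label a≢b a′≢b′ φ≉ψ sep lbl≡ with square-normal a≢b | square-normal a′≢b′
  ... | p , v<p , φ≈ | q , v′<q , ψ≈ =
    φ≉ψ λ e → trans (φ≈ e)
                (trans (same-square lbl≡ v<p v′<q (Separates-resp-≈ φ≈ ψ≈ sep) e) (sym (ψ≈ e)))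
    where
    same-square : {v v′ p q : Fin n} → v ≡ v′ → v <ᶠ p → v′ <ᶠ q →
                  Separates P₃ (pathMonomial v p v) (pathMonomial v′ q v′) →
                  pathMonomial v p v ≈ₘ pathMonomial v′ q v′
    same-square {v} refl v<p v<q sep′ e =
      cong (λ w → pathMonomial v w v e) (squares-separated (<⇒≢ v<p) (<⇒≢ v<q) sep′)

  square-cherry-label : {a b a′ b′ c′ : Fin n} → a ≢ b → a′ ≢ b′ → b′ ≢ c′ →
                        Separates P₃ (pathMonomial a b a) (pathMonomial a′ b′ c′) →
                        a ⊓ b ≢ a′ ⊔ b′ ⊔ c′
  square-cherry-label {a′ = a′} {b′} {c′} a≢b a′≢b′ b′≢c′ sep lbl≡ with square-normal a≢b
  ... | p , v<p , φ≈ =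
    square-cherry-¬Separates v<p a′≢b′ b′≢c′
      (subst (λ w → ∀ k → path a′ b′ c′ k ≤ᶠ w) (sym lbl≡) ≤-highest)
      (subst (_∈ᵥ path a′ b′ c′) (sym lbl≡) highest-∈)
      (Separates-resp-≈ φ≈ (λ _ → refl) sep)

  cherries-label : {a b c a′ b′ c′ : Fin n} →
                   a ≢ b → b ≢ c → a ≢ c → a′ ≢ b′ → b′ ≢ c′ → a′ ≢ c′ →
                   Separates P₃ (pathMonomial a b c) (pathMonomial a′ b′ c′) →
                   a ⊔ b ⊔ c ≢ a′ ⊔ b′ ⊔ c′
  cherries-label {a′ = a′} {b′} {c′} a≢b b≢c a≢c a′≢b′ b′≢c′ a′≢c′ sep lbl≡ =
    cherries-¬Separates a≢b b≢c a≢c a′≢b′ b′≢c′ a′≢c′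
      highest-∈ (subst (_∈ᵥ path a′ b′ c′) (sym lbl≡) highest-∈) sep

  label-separates : {a b c a′ b′ c′ : Fin n} → a ≢ b → b ≢ c → a′ ≢ b′ → b′ ≢ c′ →
                    ¬ pathMonomial a b c ≈ₘ pathMonomial a′ b′ c′ →
                    Separates P₃ (pathMonomial a b c) (pathMonomial a′ b′ c′) →
                    label a b c ≢ label a′ b′ c′
  label-separates {a} {b} {c} {a′} {b′} {c′} a≢b b≢c a′≢b′ b′≢c′ φ≉ψ sep with a ≟ c | a′ ≟ c′
  ... | yes refl | yes refl = squares-label a≢b a′≢b′ φ≉ψ sep
  ... | yes refl | no a′≢c′ = square-cherry-label a≢b a′≢b′ b′≢c′ sep
  ... | no a≢c   | yes refl =
    λ lbl≡ → square-cherry-label a′≢b′ a≢b b≢c (Separates-sym sep) (sym lbl≡)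
  ... | no a≢c   | no a′≢c′ = cherries-label a≢b b≢c a≢c a′≢b′ b′≢c′ a′≢c′ sep

labelOf : {m : Monomial n} → IsMonomialOfHom P₃ n m → Fin n
labelOf (φ , _ , _) = label (φ zero) (φ (suc zero)) (φ (suc (suc zero)))

labelOf-separates : {m m′ : Monomial n}
                    (hm : IsMonomialOfHom P₃ n m) (hm′ : IsMonomialOfHom P₃ n m′) →
                    ¬ m ≈ₘ m′ → Separates P₃ m m′ → labelOf hm ≢ labelOf hm′
labelOf-separates (φ , φ₀≢φ₁ ∷ φ₁≢φ₂ ∷ [] , m≈φ) (ψ , ψ₀≢ψ₁ ∷ ψ₁≢ψ₂ ∷ [] , m′≈ψ) m≉m′ sep =
  label-separates φ₀≢φ₁ φ₁≢φ₂ ψ₀≢ψ₁ ψ₁≢ψ₂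
    (λ φ≈ψ → m≉m′ λ e → trans (m≈φ e) (trans (φ≈ψ e) (sym (m′≈ψ e))))
    (Separates-resp-≈ m≈φ m′≈ψ sep)

AllPairs-lookup : {ℓ₁ ℓ₂ : Level} {A : Set ℓ₁} {R : Rel A ℓ₂} {xs : List A} →
                  Symmetric R → AllPairs R xs →
                  {i j : Fin (length xs)} → i ≢ j → R (lookup xs i) (lookup xs j)
AllPairs-lookup R-sym (_ ∷ _) {zero} {zero} i≢j = contradiction refl i≢j
AllPairs-lookup R-sym (px ∷ _) {zero} {suc j} _ = All.lookup px (∈-lookup j)
AllPairs-lookup R-sym (px ∷ _) {suc i} {zero} _ = R-sym (All.lookup px (∈-lookup i))
AllPairs-lookup R-sym (_ ∷ pxs) {suc i} {suc j} i≢j =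
  AllPairs-lookup R-sym pxs λ i≡j → i≢j (cong suc i≡j)

separatingSet-length-≤ : {S : List (Monomial n)} → NoDupₘ S → IsSeparatingSet P₃ n S → length S ≤ n
separatingSet-length-≤ {S = S} noDup (monomials , separating) = injective⇒≤ labelAt-injective
  where
  monomialAt : (i : Fin (length S)) → IsMonomialOfHom P₃ _ (lookup S i)
  monomialAt i = All.lookup monomials (∈-lookup i)

  labelAt : Fin (length S) → Fin _
  labelAt i = labelOf (monomialAt i)

  labelAt-injective : Injective _≡_ _≡_ labelAt
  labelAt-injective {i} {j} labels≡ with i ≟ j
  ... | yes i≡j = i≡j
  ... | no i≢j  = contradiction labels≡ (labelOf-separates (monomialAt i) (monomialAt j)
                    distinct (separating (∈-lookup i) (∈-lookup j) distinct))
    where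
    distinct : ¬ lookup S i ≈ₘ lookup S j
    distinct = AllPairs-lookup (λ ≉ ≈ → ≉ λ e → sym (≈ e)) noDup i≢j

mainTheorem4 : ∃[ N ] (∀ n → N ≤ n → (S : List (Monomial n)) → NoDupₘ S →
                 IsSeparatingSet P₃ n S → length S ≤ n)
mainTheorem4 = 0 , λ _ _ _ → separatingSet-length-≤
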